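{- Let $\mathcal A_{\mathbf S}$ be an $\mathbf S$-braid arrangement. Then $\mathcal A_{\mathbf S}$ has Property Y if and only if $\mathcal M_{\mathbf S}=\mathcal L_{\mathbf S}$.
   Context: Fix $n\ge1$, $[n]=\{1,\dots,n\}$, $[a;b]=\{a,\dots,b\}$. For finite sets of integers $\mathbf S=(S_{i,j})_{1\le i<j\le n}$, the $\mathbf S$-braid arrangement is $\mathcal A_{\mathbf S}=\{\{x\in\mathbb R^n:x_i-x_j=s\}:i<j,\ s\in S_{i,j}\}$. For $i<j$: $S^+_{i,j}=\{s>0:s\in S_{i,j}\}$, $S^+_{j,i}=\{s\ge0:-s\in S_{i,j}\}$; $S^+_{i,i}=\emptyset$. $m=\max\bigcup_{i\ne j}S^+_{i,j}$. Property Y: for all pairwise distinct $i,j,k\in[n]$ and every integer $s\ge0$ with $s>0$ or $j<i$: if $s\notin S^+_{i,j}$ then $s+t\notin S^+_{k,j}$ for all $t>0$. An $(m,n)$-sketch is a word in which each letter $\alpha_i^s$ ($i\in[n]$, $s\in[0;m]$) occurs exactly once, $\alpha_i^{s-1}$ occurs before $\alpha_i^s$, and for $s,t\in[m]$, if $\alpha_i^{s-1}$ occurs before $\alpha_j^{t-1}$ then $\alpha_i^s$ occurs before $\alpha_j^t$. $\mathrm{Triple}_{\mathbf S}=\{(i,j,s):i\ne j\in[n],\ s\in S^+_{i,j}\text{ or }(s=0\text{ and }i<j)\}$. $\mathcal L_{\mathbf S}$ is the set of sketches $w$ such that for each $j\in[n]$, if $s$ is maximal such that $\alpha_j^s$ is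 immediately followed in $w$ by some $\alpha_i^0$, then $(i,j,s)\in\mathrm{Triple}_{\mathbf S}$. $\mathcal M_{\mathbf S}$ is the set of sketches such that whenever $\alpha_j^s$ is immediately followed by $\alpha_i^0$, $(i,j,s)\in\mathrm{Triple}_{\mathbf S}$. -}

module Defs where

open import Data.Nat using (ℕ; zero; suc; _≤_; _<_; _⊔_)
open import Data.Integer as ℤ using (ℤ; +_; ∣_∣)
open import Data.Fin as Fin using (Fin)
open import Data.Fin.Properties using () renaming (_<?_ to _<ᶠ?_)
open import Data.List using (List; []; _∷_; _++_; map; foldr; concatMap; [_])
open import Data.List.Membership.Propositional using (_∈_)
open import Data.List.Relation.Unary.Unique.Propositional using (Unique)
open import Data.Product using (_×_; _,_; ∃; ∃-syntax; Σ-syntax)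
open import Data.Sum using (_⊎_)
open import Data.Bool using (if_then_else_)
open import Data.Empty using (⊥)
open import Relation.Nullary using (¬_; does)
open import Relation.Binary.PropositionalEquality using (_≡_; _≢_)
open import Data.List using (allFin)

-- An S-braid arrangement is given by the family S = (S i j) of finite sets of
-- integers (finite lists); only the entries with i < j are ever used.
Family : ℕ → Set
Family n = Fin n → Fin n → List ℤ

module _ {n : ℕ} (S : Family n) where

  data S⁺ (i j : Fin n) (s : ℕ) : Set where
    pos : i Fin.< j → 0 < s → (+ s) ∈ S i j → S⁺ i j s
    neg : j Fin.< i → ℤ.- (+ s) ∈ S j i → S⁺ i j s

  -- m = max of the union of all S⁺ i j  (= max of |s| over s ∈ S i j, i < j);
  -- convention: 0 if the union is empty.
  allAbs : List ℕ
  allAbs = concatMap (λ i → concatMap (λ j →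
             if does (i <ᶠ? j) then map ∣_∣ (S i j) else []) (allFin n)) (allFin n)

  mOf : ℕ
  mOf = foldr _⊔_ 0 allAbs

  PropertyY : Set
  PropertyY = ∀ (i j k : Fin n) → i ≢ j → j ≢ k → i ≢ k →
              ∀ (s : ℕ) → (0 < s ⊎ j Fin.< i) →
              ¬ S⁺ i j s → ∀ (t : ℕ) → 0 < t → ¬ S⁺ k j (s Data.Nat.+ t)

  Triple : Fin n → Fin n → ℕ → Set
  Triple i j s = i ≢ j × (S⁺ i j s ⊎ (s ≡ 0 × i Fin.< j))

-- Letters α_i^s are pairs (i , s); words are lists of letters.
Letter : ℕ → Set
Letter n = Fin n × ℕ

Word : ℕ → Set
Word n = List (Letter n)

module _ {n : ℕ} where

  Before : Word n → Letter n → Letter n → Set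
  Before w x y = ∃[ a ] ∃[ b ] ∃[ c ] (w ≡ a ++ x ∷ (b ++ y ∷ c))

  ImmFollow : Word n → Letter n → Letter n → Set
  ImmFollow w x y = ∃[ a ] ∃[ c ] (w ≡ a ++ x ∷ y ∷ c)

  IsSketch : ℕ → Word n → Set
  IsSketch m w =
      ((∀ (i : Fin n) (s : ℕ) → s ≤ m → (i , s) ∈ w)
    × (∀ (i : Fin n) (s : ℕ) → (i , s) ∈ w → s ≤ m)
    × Unique w)
    × (∀ (i : Fin n) (s : ℕ) → suc s ≤ m → Before w (i , s) (i , suc s))
    × (∀ (i j : Fin n) (s t : ℕ) → suc s ≤ m → suc t ≤ m →
         Before w (i , s) (j , t) → Before w (i , suc s) (j , suc t))

module _ {n : ℕ} (S : Family n) where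

  InM : Word n → Set
  InM w = IsSketch (mOf S) w ×
          (∀ (i j : Fin n) (s : ℕ) → ImmFollow w (j , s) (i , 0) → Triple S i j s)

  InL : Word n → Set
  InL w = IsSketch (mOf S) w ×
          (∀ (i j : Fin n) (s : ℕ) → ImmFollow w (j , s) (i , 0) →
             (∀ (i' : Fin n) (s' : ℕ) → ImmFollow w (j , s') (i' , 0) → s' ≤ s) →
             Triple S i j s)

module Submission where

-- If w ∈ L_S and α_j^s is immediately followed by α_i^0, take u maximal such that α_j^u is
-- immediately followed by some α_k^0; then (k, j, u) is a triple. Either u = s, and then k = i,
-- or s < u: then u ∈ S⁺_{k,j}, the indices i, j, k are pairwise distinct, and Property Y with
-- t = u − s makes (i, j, s) a triple, so w ∈ M_S.
-- Conversely, a failure of Property Y at (i, j, k, s, t) yields a sketch in L_S ∖ M_S: list the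
-- letters α_l^u by time u + (s if l = i, s + t if l = k, 0 otherwise), breaking ties by
-- decreasing index with α_k and then α_i placed right after α_j. There α_j^s is immediately
-- followed by α_i^0 although (i, j, s) is not a triple, but α_j^{s+t} is immediately followed by
-- α_k^0, so s is not the maximal level of j; every other α_b^0 follows, at time 0, a letter of
-- larger index.

open import Defs
open import Level using (0ℓ)
open import Data.Nat as ℕ using (ℕ; zero; suc; _+_; _∸_; _⊔_; _≤_; _<_; _<?_; z≤n; s≤s; _≤′_; ≤′-refl; ≤′-step)
open import Data.Nat.Properties
open import Data.Fin as Fin using (Fin; toℕ)
import Data.Fin.Properties as Finₚ
open import Data.Integer as ℤ using (+_; ∣_∣)
open import Data.Integer.Properties using (∣-i∣≡∣i∣)
open import Data.Bool using (if_then_else_)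
open import Data.Empty using (⊥; ⊥-elim)
open import Data.Sum using (_⊎_; inj₁; inj₂; [_,_]′)
open import Data.Product using (_×_; _,_; ∃-syntax; proj₁; proj₂; map₁)
open import Data.Product.Properties using (≡-dec)
open import Data.Product.Relation.Binary.Lex.Strict using (×-strictTotalOrder)
open import Data.Product.Relation.Binary.Pointwise.NonDependent using (≡×≡⇒≡)
open import Data.List using (List; []; _∷_; _++_; _∷ʳ_; [_]; filter; upTo; map; foldr; allFin; cartesianProduct)
open import Data.List.Properties using (∷-injective; ∷-injectiveˡ; ∷ʳ-injectiveʳ; ++-assoc; ++-identityʳ-unique; foldr-preservesᵒ)
open import Data.List.Extrema.Nat using (max; argmax-all; xs≤max)
open import Data.List.Membership.Propositional using (_∈_; lose)
open import Data.List.Membership.Propositional.Properties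
  using (∈-++⁺ʳ; ∈-∃++; ∈-filter⁺; ∈-upTo⁺; ∈-upTo⁻; ∈-map⁺; ∈-concatMap⁺; ∈-allFin; ∈-cartesianProduct⁺; ∈-cartesianProduct⁻)
open import Data.List.Membership.DecPropositional ℤ._≟_ using () renaming (_∈?_ to _∈ℤ?_)
open import Data.List.Relation.Unary.Any using (here; there)
open import Data.List.Relation.Unary.All as All using (_∷_)
open import Data.List.Relation.Unary.All.Properties using (all-filter)
open import Data.List.Relation.Unary.AllPairs as AllPairs using (AllPairs; _∷_)
open import Data.List.Relation.Unary.Unique.Propositional using (Unique)
import Data.List.Relation.Unary.Unique.Propositional.Properties as Uniqueₚ
import Data.List.Relation.Unary.Sorted.TotalOrder.Properties as Sortedₚ
open import Data.List.Relation.Binary.Permutation.Propositional using (↭-sym; ↭⇒↭ₛ)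
open import Data.List.Relation.Binary.Permutation.Propositional.Properties using (∈-resp-↭)
open import Data.List.Relation.Binary.Permutation.Setoid.Properties using (Unique-resp-↭)
open import Data.List.Relation.Binary.Infix.Heterogeneous using (Infix; here; MkView; toView; _++ⁱ_)
open import Data.List.Relation.Binary.Infix.Heterogeneous.Properties using (infix?)
open import Data.List.Relation.Binary.Prefix.Heterogeneous using ([]; _∷_)
open import Data.List.Relation.Binary.Pointwise using ([]; _∷_)
open import Function using (_∘_; id)
open import Function.Bundles using (_⇔_; mk⇔; Equivalence)
open import Relation.Nullary using (¬_; Dec; yes; no; does; _×-dec_)
open import Relation.Nullary.Decidable using (map′; dec-true)
open import Relation.Unary using (Decidable)
open import Relation.Binary.Bundles using (StrictTotalOrder; DecTotalOrder)
open import Relation.Binary.Definitions using (DecidableEquality; Asymmetric; tri<; tri≈; tri>)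
import Relation.Binary.Construct.Flip.EqAndOrd as Flip
import Relation.Binary.Construct.On as On
import Relation.Binary.Properties.StrictTotalOrder as StrictTotalOrderₚ
open import Relation.Binary.PropositionalEquality
  using (_≡_; _≢_; refl; sym; trans; cong; cong₂; subst; subst₂; setoid; module ≡-Reasoning)

unique-split : ∀ {A : Set} (a a' : List A) {x : A} {c c' : List A} → Unique (a ++ x ∷ c) →
               a ++ x ∷ c ≡ a' ++ x ∷ c' → a ≡ a' × c ≡ c'
unique-split [] [] _ refl = refl , refl
unique-split [] (_ ∷ a') (x∉ ∷ _) refl = ⊥-elim (All.lookup x∉ (∈-++⁺ʳ a' (here refl)) refl)
unique-split (_ ∷ a) [] (x∉ ∷ _) refl = ⊥-elim (All.lookup x∉ (∈-++⁺ʳ a (here refl)) refl)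
unique-split (_ ∷ a) (_ ∷ a') (_ ∷ u) e
  with refl , e′ ← ∷-injective e
  with refl , refl ← unique-split a a' u e′ = refl , refl

_≟ₗ_ : ∀ {n} → DecidableEquality (Letter n)
_≟ₗ_ = ≡-dec Finₚ._≟_ ℕ._≟_

module _ {n : ℕ} where

  private variable
    w : Word n
    x y z : Letter n

  immFollow⇒before : ImmFollow w x y → Before w x y
  immFollow⇒before (a , c , e) = a , [] , c , e

  before⇒∈ˡ : Before w x y → x ∈ w
  before⇒∈ˡ (a , _ , _ , refl) = ∈-++⁺ʳ a (here refl)

  immFollow-functional : Unique w → ImmFollow w x y → ImmFollow w x z → y ≡ z
  immFollow-functional u (a , c , refl) (a' , c' , e) = ∷-injectiveˡ (proj₂ (unique-split a a' u e))

  immFollow-injective : Unique w → ImmFollow w x z → ImmFollow w y z → x ≡ y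
  immFollow-injective {x = x} {z} {y} u (a , c , refl) (a' , c' , e) =
    ∷ʳ-injectiveʳ a a' (proj₁ (unique-split (a ∷ʳ x) (a' ∷ʳ y) (subst Unique (sym regroup) u) (begin
      (a ∷ʳ x) ++ z ∷ c    ≡⟨ regroup ⟩
      a ++ x ∷ z ∷ c       ≡⟨ e ⟩
      a' ++ y ∷ z ∷ c'     ≡⟨ ++-assoc a' [ y ] (z ∷ c') ⟨
      (a' ∷ʳ y) ++ z ∷ c'  ∎)))
    where
    open ≡-Reasoning
    regroup : (a ∷ʳ x) ++ z ∷ c ≡ a ++ x ∷ z ∷ c
    regroup = ++-assoc a [ x ] (z ∷ c)

  before-trans : Unique w → Before w x y → Before w y z → Before w x z
  before-trans {x = x} {y} {z} u (a , b , c , refl) (a' , b' , c' , e)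
    with refl , refl ← unique-split (a ++ x ∷ b) a' (subst Unique (sym (++-assoc a (x ∷ b) (y ∷ c))) u)
                                    (trans (++-assoc a (x ∷ b) (y ∷ c)) e)
    = a , b ++ y ∷ b' , c' , cong (λ r → a ++ x ∷ r) (sym (++-assoc b (y ∷ b') (z ∷ c')))

  before-irrefl : Unique w → ¬ Before w x x
  before-irrefl {x = x} u (a , b , c , refl)
    with () ← ++-identityʳ-unique a (proj₁ (unique-split a (a ++ x ∷ b) u (sym (++-assoc a (x ∷ b) (x ∷ c)))))

  immFollow? : (w : Word n) (x y : Letter n) → Dec (ImmFollow w x y)
  immFollow? w x y = map′ fromInfix toInfix (infix? _≟ₗ_ (x ∷ y ∷ []) w)
    where
    fromInfix : Infix _≡_ (x ∷ y ∷ []) w → ImmFollow w x y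
    fromInfix p with MkView a (refl ∷ refl ∷ []) c ← toView p = a , c , refl
    toInfix : ImmFollow w x y → Infix _≡_ (x ∷ y ∷ []) w
    toInfix (a , c , refl) = a ++ⁱ here (refl ∷ refl ∷ [])

  module _ {R : Letter n → Letter n → Set} where

    sorted-before⇒R : AllPairs R w → Before w x y → R x y
    sorted-before⇒R sorted (a , b , c , refl) = go a sorted
      where
      go : ∀ a {b c} → AllPairs R (a ++ x ∷ (b ++ y ∷ c)) → R x y
      go [] {b} (x< ∷ _) = All.lookup x< (∈-++⁺ʳ b (here refl))
      go (_ ∷ a) (_ ∷ sorted) = go a sorted

    sorted-R⇒before : Asymmetric R → AllPairs R w → x ∈ w → y ∈ w → R x y → Before w x y
    sorted-R⇒before asym _ (here refl) (here refl) r = ⊥-elim (asym r r)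
    sorted-R⇒before asym _ (here refl) (there q) _ with b , c , refl ← ∈-∃++ q = [] , b , c , refl
    sorted-R⇒before asym (h< ∷ _) (there p) (here refl) r = ⊥-elim (asym r (All.lookup h< p))
    sorted-R⇒before {w = h ∷ _} asym (_ ∷ sorted) (there p) (there q) r
      with a , b , c , refl ← sorted-R⇒before asym sorted p q r = h ∷ a , b , c , refl

    sorted-consecutive⇒immFollow : Asymmetric R → AllPairs R w → x ∈ w → y ∈ w → R x y →
                                   (∀ {z} → z ∈ w → R x z → R z y → ⊥) → ImmFollow w x y
    sorted-consecutive⇒immFollow asym _ (here refl) (here refl) r _ = ⊥-elim (asym r r)
    sorted-consecutive⇒immFollow {w = _ ∷ _ ∷ c} asym _ (here refl) (there (here refl)) _ _ = [] , c , refl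
    sorted-consecutive⇒immFollow asym (x< ∷ h< ∷ _) (here refl) (there (there q)) _ gap =
      ⊥-elim (gap (there (here refl)) (All.lookup x< (here refl)) (All.lookup h< q))
    sorted-consecutive⇒immFollow asym (h< ∷ _) (there p) (here refl) r _ = ⊥-elim (asym r (All.lookup h< p))
    sorted-consecutive⇒immFollow {w = h ∷ _} asym (_ ∷ sorted) (there p) (there q) r gap
      with a , c , refl ← sorted-consecutive⇒immFollow asym sorted p q r (gap ∘ there) = h ∷ a , c , refl

  module _ {m : ℕ} (sketch : IsSketch m w) where

    sketch-unique : Unique w
    sketch-unique = proj₂ (proj₂ (proj₁ sketch))

    sketch-bounded : ∀ {l u} → (l , u) ∈ w → u ≤ m
    sketch-bounded = proj₁ (proj₂ (proj₁ sketch)) _ _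

    sketch-before-higher : ∀ j {u v} → u ≤ v → suc v ≤ m → Before w (j , u) (j , suc v)
    sketch-before-higher j u≤v = go (≤⇒≤′ u≤v)
      where
      go : ∀ {u v} → u ≤′ v → suc v ≤ m → Before w (j , u) (j , suc v)
      go ≤′-refl v<m = proj₁ (proj₂ sketch) j _ v<m
      go (≤′-step u≤v) v<m = before-trans sketch-unique (go u≤v (<⇒≤ v<m)) (proj₁ (proj₂ sketch) j _ v<m)

    sketch-¬immFollow-own-zero : ∀ j s → ¬ ImmFollow w (j , s) (j , 0)
    sketch-¬immFollow-own-zero j zero j→j = before-irrefl sketch-unique (immFollow⇒before j→j)
    sketch-¬immFollow-own-zero j (suc s) j→j = before-irrefl sketch-unique (before-trans sketch-unique
      (sketch-before-higher j z≤n (sketch-bounded (before⇒∈ˡ (immFollow⇒before j→j))))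
      (immFollow⇒before j→j))

maximum-exists : {P : ℕ → Set} → Decidable P → (m : ℕ) → (∀ {v} → P v → v ≤ m) →
                 ∀ {s} → P s → ∃[ u ] P u × (∀ {v} → P v → v ≤ u)
maximum-exists {P} P? m bounded {s} ps =
  max s candidates , argmax-all id ps (all-filter P? (upTo (suc m))) , below-max
  where
  candidates : List ℕ
  candidates = filter P? (upTo (suc m))
  below-max : ∀ {v} → P v → v ≤ max s candidates
  below-max pv = All.lookup (xs≤max s candidates) (∈-filter⁺ P? (∈-upTo⁺ (s≤s (bounded pv))) pv)

≤-foldr-⊔ : ∀ {v xs} → v ∈ xs → v ≤ foldr _⊔_ 0 xs
≤-foldr-⊔ {v} {xs} v∈ = foldr-preservesᵒ {P = v ≤_} upper 0 xs (inj₂ (lose v∈ ≤-refl))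
  where
  upper : ∀ x y → v ≤ x ⊎ v ≤ y → v ≤ x ⊔ y
  upper x y (inj₁ v≤x) = m≤n⇒m≤n⊔o y v≤x
  upper x y (inj₂ v≤y) = m≤n⇒m≤o⊔n x v≤y

module _ {n : ℕ} (S : Family n) where

  ∈-allAbs : ∀ {i j v} → i Fin.< j → v ∈ map ∣_∣ (S i j) → v ∈ allAbs S
  ∈-allAbs {i} {j} i<j v∈ = ∈-concatMap⁺ _ (lose (∈-allFin i) (∈-concatMap⁺ _ (lose (∈-allFin j) in-row)))
    where
    in-row : _ ∈ (if does (i Finₚ.<? j) then map ∣_∣ (S i j) else [])
    in-row rewrite dec-true (i Finₚ.<? j) i<j = v∈

  S⁺⇒≤mOf : ∀ {i j s} → S⁺ S i j s → s ≤ mOf S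
  S⁺⇒≤mOf (pos i<j _ s∈) = ≤-foldr-⊔ (∈-allAbs i<j (∈-map⁺ ∣_∣ s∈))
  S⁺⇒≤mOf {i} {j} {s} (neg j<i s∈) =
    ≤-foldr-⊔ (∈-allAbs j<i (subst (_∈ map ∣_∣ (S j i)) (∣-i∣≡∣i∣ (+ s)) (∈-map⁺ ∣_∣ s∈)))

  S⁺? : ∀ i j s → Dec (S⁺ S i j s)
  S⁺? i j s with Finₚ.<-cmp i j
  ... | tri< i<j _ _ = map′ (λ (0<s , s∈) → pos i<j 0<s s∈) from-pos ((0 <? s) ×-dec (+ s ∈ℤ? S i j))
    where
    from-pos : S⁺ S i j s → 0 < s × + s ∈ S i j
    from-pos (pos _ 0<s s∈) = 0<s , s∈
    from-pos (neg j<i _) = ⊥-elim (Finₚ.<-asym i<j j<i)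
  ... | tri≈ _ refl _ = no λ { (pos i<i _ _) → Finₚ.<-irrefl refl i<i ; (neg i<i _) → Finₚ.<-irrefl refl i<i }
  ... | tri> _ _ j<i = map′ (neg j<i) from-neg (ℤ.- + s ∈ℤ? S j i)
    where
    from-neg : S⁺ S i j s → ℤ.- + s ∈ S j i
    from-neg (pos i<j _ _) = ⊥-elim (Finₚ.<-asym i<j j<i)
    from-neg (neg _ s∈) = s∈

  ¬Triple : ∀ {i j s} → ¬ S⁺ S i j s → 0 < s ⊎ j Fin.< i → ¬ Triple S i j s
  ¬Triple ¬i→j _ (_ , inj₁ i→j) = ¬i→j i→j
  ¬Triple _ (inj₁ 0<0) (_ , inj₂ (refl , _)) = n≮0 0<0
  ¬Triple _ (inj₂ j<i) (_ , inj₂ (_ , i<j)) = Finₚ.<-asym i<j j<i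

-- Property Y implies L_S ⊆ M_S

module _ {n : ℕ} (S : Family n) where

  PropertyY⇒Triple : PropertyY S → ∀ {i j k s u} → i ≢ j → j ≢ k → i ≢ k →
                     s < u → S⁺ S k j u → Triple S i j s
  PropertyY⇒Triple Y {i} {j} {k} {s} {u} i≢j j≢k i≢k s<u k→j with S⁺? S i j s
  ... | yes i→j = i≢j , inj₁ i→j
  ... | no ¬i→j = i≢j , inj₂ (s≡0 , i<j)
    where
    impossible : 0 < s ⊎ j Fin.< i → ⊥
    impossible cond = Y i j k i≢j j≢k i≢k s cond ¬i→j (u ∸ s) (m<n⇒0<n∸m s<u)
                        (subst (S⁺ S k j) (sym (m+[n∸m]≡n (<⇒≤ s<u))) k→j)
    s≡0 : s ≡ 0
    s≡0 = n≤0⇒n≡0 (≮⇒≥ (impossible ∘ inj₁))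
    i<j : i Fin.< j
    i<j with Finₚ.<-cmp i j
    ... | tri< i<j _ _ = i<j
    ... | tri≈ _ i≡j _ = ⊥-elim (i≢j i≡j)
    ... | tri> _ _ j<i = ⊥-elim (impossible (inj₂ j<i))

  triple-below-maximal : PropertyY S → ∀ {w i j k s u} → IsSketch (mOf S) w →
                         ImmFollow w (j , s) (i , 0) → ImmFollow w (j , u) (k , 0) →
                         s ≤ u → Triple S k j u → Triple S i j s
  triple-below-maximal Y {i = i} {j} {k} {s} {u} sketch j→i j→k s≤u (k≢j , k→j) with m≤n⇒m<n∨m≡n s≤u
  ... | inj₂ refl =
    subst (λ l → Triple S l j s) (cong proj₁ (immFollow-functional (sketch-unique sketch) j→k j→i)) (k≢j , k→j)
  ... | inj₁ s<u = PropertyY⇒Triple Y i≢j (k≢j ∘ sym) i≢k s<u (positive k→j)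
    where
    i≢j : i ≢ j
    i≢j refl = sketch-¬immFollow-own-zero sketch j s j→i
    i≢k : i ≢ k
    i≢k refl = <⇒≢ s<u (cong proj₂ (immFollow-injective (sketch-unique sketch) j→i j→k))
    positive : S⁺ S k j u ⊎ (u ≡ 0 × k Fin.< j) → S⁺ S k j u
    positive (inj₁ k→j⁺) = k→j⁺
    positive (inj₂ (refl , _)) = ⊥-elim (n≮0 s<u)

  PropertyY⇒L⊆M : PropertyY S → ∀ {w} → InL S w → InM S w
  PropertyY⇒L⊆M Y {w} (sketch , triple-at-maximal) = sketch , triple
    where
    Followed : Fin n → ℕ → Set
    Followed j u = ∃[ k ] ImmFollow w (j , u) (k , 0)
    bounded : ∀ {j u} → Followed j u → u ≤ mOf S
    bounded (_ , j→k) = sketch-bounded sketch (before⇒∈ˡ (immFollow⇒before j→k))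
    triple : ∀ i j s → ImmFollow w (j , s) (i , 0) → Triple S i j s
    triple i j s j→i
      with u , (k , j→k) , maximal ← maximum-exists (λ u → Finₚ.any? λ k → immFollow? w (j , u) (k , 0))
                                                     (mOf S) bounded (i , j→i)
      = triple-below-maximal Y sketch j→i j→k (maximal (i , j→i))
          (triple-at-maximal k j u j→k (λ i' s' j→i' → maximal (i' , j→i')))

  M⊆L : ∀ {w} → InM S w → InL S w
  M⊆L (sketch , triple) = sketch , λ i j s j→i _ → triple i j s j→i

Key : Set
Key = ℕ × ℕ × ℕ

keyOrder : StrictTotalOrder 0ℓ 0ℓ 0ℓ
keyOrder = ×-strictTotalOrder <-strictTotalOrder
             (×-strictTotalOrder (Flip.strictTotalOrder <-strictTotalOrder) <-strictTotalOrder)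

open StrictTotalOrder keyOrder using () renaming (_<_ to _<ₖ_; asym to <ₖ-asym)

<ₖ-suc : ∀ {τ τ' r r'} → (τ , r) <ₖ (τ' , r') → (suc τ , r) <ₖ (suc τ' , r')
<ₖ-suc (inj₁ τ<τ') = inj₁ (s≤s τ<τ')
<ₖ-suc (inj₂ (τ≡τ' , r<r')) = inj₂ (cong suc τ≡τ' , r<r')

<ₖ-between : ∀ {τ p c c' x} → (τ , p , c) <ₖ x → x <ₖ (τ , p , c') →
             x ≡ (τ , p , proj₂ (proj₂ x)) × c < proj₂ (proj₂ x) × proj₂ (proj₂ x) < c'
<ₖ-between (inj₁ τ<τ') (inj₁ τ'<τ) = ⊥-elim (<-asym τ<τ' τ'<τ)
<ₖ-between (inj₁ τ<τ) (inj₂ (refl , _)) = ⊥-elim (<-irrefl refl τ<τ)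
<ₖ-between (inj₂ (refl , _)) (inj₁ τ<τ) = ⊥-elim (<-irrefl refl τ<τ)
<ₖ-between (inj₂ (refl , inj₁ q<p)) (inj₂ (_ , inj₁ p<q)) = ⊥-elim (<-asym q<p p<q)
<ₖ-between (inj₂ (refl , inj₁ p<p)) (inj₂ (_ , inj₂ (refl , _))) = ⊥-elim (<-irrefl refl p<p)
<ₖ-between (inj₂ (refl , inj₂ (refl , _))) (inj₂ (_ , inj₁ p<p)) = ⊥-elim (<-irrefl refl p<p)
<ₖ-between (inj₂ (refl , inj₂ (refl , c<d))) (inj₂ (_ , inj₂ (_ , d<c'))) = refl , c<d , d<c'

<ₖ-time-zero : ∀ {τ q c p} → (τ , q , c) <ₖ (0 , p , 0) → τ ≡ 0 × p < q
<ₖ-time-zero (inj₁ τ<0) = ⊥-elim (n≮0 τ<0)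
<ₖ-time-zero (inj₂ (τ≡0 , inj₁ p<q)) = τ≡0 , p<q
<ₖ-time-zero (inj₂ (_ , inj₂ (_ , c<0))) = ⊥-elim (n≮0 c<0)

module SortBy {A : Set} (key : A → Key) (key-injective : ∀ {x y} → key x ≡ key y → x ≡ y) where

  private
    byKey : DecTotalOrder 0ℓ 0ℓ 0ℓ
    byKey = StrictTotalOrderₚ.decTotalOrder (On.strictTotalOrder keyOrder key)

  open import Data.List.Sort byKey using (sort; sort-↭; sort-↗) public

  sort-unique : ∀ {xs} → Unique xs → Unique (sort xs)
  sort-unique {xs} = Unique-resp-↭ (setoid A) (↭⇒↭ₛ (↭-sym (sort-↭ xs)))

  sort-strictly-sorted : ∀ {xs} → Unique xs → AllPairs (λ x y → key x <ₖ key y) (sort xs)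
  sort-strictly-sorted {xs} u = AllPairs.zipWith strict
    (Sortedₚ.Sorted⇒AllPairs (DecTotalOrder.totalOrder byKey) (sort-↗ xs) , sort-unique u)
    where
    strict : ∀ {x y} → DecTotalOrder._≤_ byKey x y × x ≢ y → key x <ₖ key y
    strict (inj₁ x<y , _) = x<y
    strict (inj₂ x≈y , x≢y) = ⊥-elim (x≢y (key-injective (≡×≡⇒≡ (proj₁ x≈y , ≡×≡⇒≡ (proj₂ x≈y)))))

-- A sketch in L_S ∖ M_S from a failure of Property Y

module Counterexample {n : ℕ} (S : Family n) {i j k : Fin n} (i≢j : i ≢ j) (j≢k : j ≢ k) (i≢k : i ≢ k)
                      {s t : ℕ} (cond : 0 < s ⊎ j Fin.< i) (0<t : 0 < t) (k→j : S⁺ S k j (s + t)) where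

  data Role (l : Fin n) : Set where
    is-i : l ≡ i → Role l
    is-k : l ≡ k → Role l
    other : l ≢ i → l ≢ k → Role l

  role : ∀ l → Role l
  role l with l Finₚ.≟ i | l Finₚ.≟ k
  ... | yes l≡i | _ = is-i l≡i
  ... | no _ | yes l≡k = is-k l≡k
  ... | no l≢i | no l≢k = other l≢i l≢k

  -- (time, position, tag): α_i and α_k take the position of j and follow α_j through their tags.
  keyOf : ∀ {l} → ℕ → Role l → Key
  keyOf u (is-i _) = u + s , toℕ j , 2
  keyOf u (is-k _) = u + (s + t) , toℕ j , 1
  keyOf {l} u (other _ _) = u , toℕ l , 0

  key : Letter n → Key
  key (l , u) = keyOf u (role l)

  key-i : ∀ u → key (i , u) ≡ (u + s , toℕ j , 2)
  key-i u with role i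
  ... | is-i _ = refl
  ... | is-k i≡k = ⊥-elim (i≢k i≡k)
  ... | other i≢i _ = ⊥-elim (i≢i refl)

  key-k : ∀ u → key (k , u) ≡ (u + (s + t) , toℕ j , 1)
  key-k u with role k
  ... | is-i k≡i = ⊥-elim (i≢k (sym k≡i))
  ... | is-k _ = refl
  ... | other _ k≢k = ⊥-elim (k≢k refl)

  key-other : ∀ {l} u → l ≢ i → l ≢ k → key (l , u) ≡ (u , toℕ l , 0)
  key-other {l} u l≢i l≢k with role l
  ... | is-i l≡i = ⊥-elim (l≢i l≡i)
  ... | is-k l≡k = ⊥-elim (l≢k l≡k)
  ... | other _ _ = refl

  key-suc : ∀ l u → key (l , suc u) ≡ map₁ suc (key (l , u))
  key-suc l u with role l
  ... | is-i _ = refl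
  ... | is-k _ = refl
  ... | other _ _ = refl

  key-injective : ∀ {x y} → key x ≡ key y → x ≡ y
  key-injective {l , u} {l' , u'} = go (role l) (role l')
    where
    go : (r : Role l) (r' : Role l') → keyOf u r ≡ keyOf u' r' → (l , u) ≡ (l' , u')
    go (is-i refl) (is-i refl) e = cong (i ,_) (+-cancelʳ-≡ _ u u' (cong proj₁ e))
    go (is-k refl) (is-k refl) e = cong (k ,_) (+-cancelʳ-≡ _ u u' (cong proj₁ e))
    go (other _ _) (other _ _) e = cong₂ _,_ (Finₚ.toℕ-injective (cong (proj₁ ∘ proj₂) e)) (cong proj₁ e)
    go (is-i _) (is-k _) ()
    go (is-i _) (other _ _) ()
    go (is-k _) (is-i _) ()
    go (is-k _) (other _ _) ()
    go (other _ _) (is-i _) ()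
    go (other _ _) (is-k _) ()

  _≺_ : Letter n → Letter n → Set
  x ≺ y = key x <ₖ key y

  ≺-suc : ∀ {l l' u u'} → (l , u) ≺ (l' , u') → (l , suc u) ≺ (l' , suc u')
  ≺-suc {l} {l'} {u} {u'} l≺l' = subst₂ _<ₖ_ (sym (key-suc l u)) (sym (key-suc l' u')) (<ₖ-suc l≺l')

  ≺-raise : ∀ l u → (l , u) ≺ (l , suc u)
  ≺-raise l u = subst (key (l , u) <ₖ_) (sym (key-suc l u)) (inj₁ ≤-refl)

  open SortBy key key-injective

  m : ℕ
  m = mOf S

  letters : List (Letter n)
  letters = cartesianProduct (allFin n) (upTo (suc m))

  letters-unique : Unique letters
  letters-unique = Uniqueₚ.cartesianProduct⁺ (Uniqueₚ.allFin⁺ n) (Uniqueₚ.upTo⁺ (suc m))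

  w : Word n
  w = sort letters

  w-sorted : AllPairs _≺_ w
  w-sorted = sort-strictly-sorted letters-unique

  ∈w : ∀ {l u} → u ≤ m → (l , u) ∈ w
  ∈w u≤m = ∈-resp-↭ (↭-sym (sort-↭ letters)) (∈-cartesianProduct⁺ (∈-allFin _) (∈-upTo⁺ (s≤s u≤m)))

  ∈w⇒≤ : ∀ {l u} → (l , u) ∈ w → u ≤ m
  ∈w⇒≤ l∈ = ≤-pred (∈-upTo⁻ (proj₂ (∈-cartesianProduct⁻ (allFin n) (upTo (suc m)) (∈-resp-↭ (sort-↭ letters) l∈))))

  sketch : IsSketch m w
  sketch = ((λ _ _ → ∈w) , (λ _ _ → ∈w⇒≤) , sort-unique letters-unique) , step , shift
    where
    step : ∀ l u → suc u ≤ m → Before w (l , u) (l , suc u)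
    step l u u<m = sorted-R⇒before <ₖ-asym w-sorted (∈w (<⇒≤ u<m)) (∈w u<m) (≺-raise l u)
    shift : ∀ a b u v → suc u ≤ m → suc v ≤ m → Before w (a , u) (b , v) → Before w (a , suc u) (b , suc v)
    shift a b u v u<m v<m a<b =
      sorted-R⇒before <ₖ-asym w-sorted (∈w u<m) (∈w v<m) (≺-suc {a} {b} {u} {v} (sorted-before⇒R w-sorted a<b))

  s<u+[s+t] : ∀ u → s < u + (s + t)
  s<u+[s+t] u = <-≤-trans (m<m+n s 0<t) (m≤n+m (s + t) u)

  s≡0⇒j<i : s ≡ 0 → j Fin.< i
  s≡0⇒j<i refl = [ (λ 0<0 → ⊥-elim (n≮0 0<0)) , id ]′ cond

  s+t≤m : s + t ≤ m
  s+t≤m = S⁺⇒≤mOf S k→j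

  j→i : ImmFollow w (j , s) (i , 0)
  j→i = sorted-consecutive⇒immFollow <ₖ-asym w-sorted (∈w (≤-trans (m≤m+n s t) s+t≤m)) (∈w z≤n) j≺i gap
    where
    key-j : key (j , s) ≡ (s , toℕ j , 0)
    key-j = key-other s (i≢j ∘ sym) j≢k
    j≺i : (j , s) ≺ (i , 0)
    j≺i = subst₂ _<ₖ_ (sym key-j) (sym (key-i 0)) (inj₂ (refl , inj₂ (refl , s≤s z≤n)))
    gap : ∀ {z} → z ∈ w → (j , s) ≺ z → z ≺ (i , 0) → ⊥
    gap {l , u} _ j≺z z≺i = go (role l) (subst (_<ₖ key (l , u)) key-j j≺z) (subst (key (l , u) <ₖ_) (key-i 0) z≺i)
      where
      go : (r : Role l) → (s , toℕ j , 0) <ₖ keyOf u r → keyOf u r <ₖ (s , toℕ j , 2) → ⊥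
      go (is-i _) p q = <-irrefl refl (proj₂ (proj₂ (<ₖ-between p q)))
      go (is-k _) p q = <⇒≢ (s<u+[s+t] u) (sym (cong proj₁ (proj₁ (<ₖ-between p q))))
      go (other _ _) p q = <-irrefl refl (proj₁ (proj₂ (<ₖ-between p q)))

  j→k : ImmFollow w (j , s + t) (k , 0)
  j→k = sorted-consecutive⇒immFollow <ₖ-asym w-sorted (∈w s+t≤m) (∈w z≤n) j≺k gap
    where
    key-j : key (j , s + t) ≡ (s + t , toℕ j , 0)
    key-j = key-other (s + t) (i≢j ∘ sym) j≢k
    j≺k : (j , s + t) ≺ (k , 0)
    j≺k = subst₂ _<ₖ_ (sym key-j) (sym (key-k 0)) (inj₂ (refl , inj₂ (refl , s≤s z≤n)))
    gap : ∀ {z} → z ∈ w → (j , s + t) ≺ z → z ≺ (k , 0) → ⊥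
    gap {z} _ j≺z z≺k
      with _ , 0<c , c<1 ← <ₖ-between (subst (_<ₖ key z) key-j j≺z) (subst (key z <ₖ_) (key-k 0) z≺k)
      = <-irrefl refl (<-≤-trans 0<c (≤-pred c<1))

  triple-below : ∀ {a b u} → (a , u) ≺ (b , 0) → b ≢ i → b ≢ k → Triple S b a u
  triple-below {a} {b} {u} a≺b b≢i b≢k = go (role a) (subst (key (a , u) <ₖ_) (key-other 0 b≢i b≢k) a≺b)
    where
    ordered : u ≡ 0 → b Fin.< a → Triple S b a u
    ordered refl b<a = Finₚ.<⇒≢ b<a , inj₂ (refl , b<a)
    go : (r : Role a) → keyOf u r <ₖ (0 , toℕ b , 0) → Triple S b a u
    go (is-i refl) lt with u+s≡0 , b<j ← <ₖ-time-zero lt =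
      ordered (m+n≡0⇒m≡0 u u+s≡0) (<-trans b<j (s≡0⇒j<i (m+n≡0⇒n≡0 u u+s≡0)))
    go (is-k refl) lt = ⊥-elim (n≮0 (subst (s <_) (proj₁ (<ₖ-time-zero lt)) (s<u+[s+t] u)))
    go (other _ _) lt with u≡0 , b<a ← <ₖ-time-zero lt = ordered u≡0 b<a

  inL : InL S w
  inL = sketch , triple
    where
    triple : ∀ b a u → ImmFollow w (a , u) (b , 0) →
             (∀ b' u' → ImmFollow w (a , u') (b' , 0) → u' ≤ u) → Triple S b a u
    triple b a u a→b maximal with role b
    ... | is-i refl with refl ← immFollow-injective (sketch-unique sketch) a→b j→i =
      ⊥-elim (<⇒≱ (m<m+n s 0<t) (maximal k (s + t) j→k))
    ... | is-k refl with refl ← immFollow-injective (sketch-unique sketch) a→b j→k = (j≢k ∘ sym) , inj₁ k→j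
    ... | other b≢i b≢k = triple-below (sorted-before⇒R w-sorted (immFollow⇒before a→b)) b≢i b≢k

L⊆M⇒PropertyY : ∀ {n} (S : Family n) → (∀ {w} → InL S w → InM S w) → PropertyY S
L⊆M⇒PropertyY S L⊆M i j k i≢j j≢k i≢k s cond ¬i→j t 0<t k→j =
  ¬Triple S ¬i→j cond (proj₂ (L⊆M inL) i j s j→i)
  where open Counterexample S i≢j j≢k i≢k cond 0<t k→j

lemma4p4 : (n : ℕ) → 1 ≤ n → (S : Family n) →
           PropertyY S ⇔ (∀ (w : Word n) → InM S w ⇔ InL S w)
lemma4p4 n _ S = mk⇔ (λ Y _ → mk⇔ (M⊆L S) (PropertyY⇒L⊆M S Y))
                     (λ M⇔L → L⊆M⇒PropertyY S (Equivalence.from (M⇔L _)))
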